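{- Every $\mathrm{MSO}_2$-orderable class of graphs $\mathcal C$ has property $\mathsf{SEP}(f)$ for some elementary function $f$.
   Context: Graphs are finite, simple, undirected. For $G=\langle V,E\rangle$, $\lceil G\rceil=\langle V\cup E,\mathrm{inc}\rangle$. A class $\mathcal C$ is $\mathrm{MSO}_2$-orderable if there is an MSO-formula $\varphi(x,y;\bar Z)$ such that for every nonempty $G\in\mathcal C$ there are sets $\bar P\subseteq V\cup E$ with $\{(a,b):\lceil G\rceil\models\varphi(a,b;\bar P)\}$ a linear order on $V\cup E$. $\mathrm{Sep}(G,k)$ is the maximal number of connected components of $G-S$ over vertex sets $S$ with $|S|\le k$; $\mathcal C$ has property $\mathsf{SEP}(f)$ if $\mathrm{Sep}(G,k)\le f(k)$ for all $G\in\mathcal C$ and $k\in\mathbb N$. A function $f:\mathbb N\to\mathbb N$ is elementary if $f\le\exp_j$ for some fixed $j$, where $\exp_0(n)=n$, $\exp_{j+1}(n)=2^{\exp_j(n)}$. -}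

module Defs where

open import Data.Nat using (ℕ; zero; suc; _^_; _≤_; _<_)
open import Data.Nat.Base using (_<ᵇ_)
open import Data.Bool using (Bool; true; false; T; _∧_)
open import Data.Fin using (Fin; zero; suc; toℕ)
open import Data.Fin.Subset using (Subset; _∈_; _∉_; ∣_∣)
open import Data.Sum using (_⊎_; inj₁; inj₂)
open import Data.Product using (Σ; _×_; _,_; proj₁; proj₂)
open import Data.Empty using (⊥)
open import Relation.Nullary using (¬_)
open import Relation.Binary.PropositionalEquality using (_≡_)
open import Relation.Binary.Structures using (IsTotalOrder)
open import Relation.Binary.Construct.Closure.ReflexiveTransitive using (Star)

record Graph : Set where
  field
    n     : ℕ
    adj   : Fin n → Fin n → Bool
    sym   : ∀ i j → adj i j ≡ adj j i
    irref : ∀ i → adj i i ≡ false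
open Graph public

Vertex : Graph → Set
Vertex G = Fin (n G)

-- an edge {i,j} is represented by the unique ordered pair (i , j) with i < j
isEdge : (G : Graph) → Vertex G × Vertex G → Bool
isEdge G (i , j) = (toℕ i <ᵇ toℕ j) ∧ adj G i j

Edge : Graph → Set
Edge G = Σ (Vertex G × Vertex G) (λ p → T (isEdge G p))

Univ : Graph → Set
Univ G = Vertex G ⊎ Edge G

Inc : (G : Graph) → Univ G → Univ G → Set
Inc G (inj₁ v) (inj₂ ((i , j) , _)) = (v ≡ i) ⊎ (v ≡ j)
Inc G (inj₁ _) (inj₁ _) = ⊥
Inc G (inj₂ _) _ = ⊥

-- MSO formulas over the signature {inc} (with equality),
-- k free first-order variables, m free set variables (de Bruijn)

data Formula (k m : ℕ) : Set where
  inc  : Fin k → Fin k → Formula k m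
  eq   : Fin k → Fin k → Formula k m
  mem  : Fin k → Fin m → Formula k m
  neg  : Formula k m → Formula k m
  and  : Formula k m → Formula k m → Formula k m
  or   : Formula k m → Formula k m → Formula k m
  ex1  : Formula (suc k) m → Formula k m
  all1 : Formula (suc k) m → Formula k m
  ex2  : Formula k (suc m) → Formula k m
  all2 : Formula k (suc m) → Formula k m

extend : ∀ {k} {A : Set} → A → (Fin k → A) → Fin (suc k) → A
extend a ρ zero    = a
extend a ρ (suc i) = ρ i

-- satisfaction in ⌈G⌉; set variables range over all subsets of V ∪ E
Sat : (G : Graph) {k m : ℕ} → Formula k m →
      (Fin k → Univ G) → (Fin m → Univ G → Bool) → Set
Sat G (inc x y) ρ σ = Inc G (ρ x) (ρ y)
Sat G (eq x y)  ρ σ = ρ x ≡ ρ y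
Sat G (mem x Z) ρ σ = T (σ Z (ρ x))
Sat G (neg φ)   ρ σ = ¬ Sat G φ ρ σ
Sat G (and φ ψ) ρ σ = Sat G φ ρ σ × Sat G ψ ρ σ
Sat G (or φ ψ)  ρ σ = Sat G φ ρ σ ⊎ Sat G ψ ρ σ
Sat G (ex1 φ)   ρ σ = Σ (Univ G) (λ a → Sat G φ (extend a ρ) σ)
Sat G (all1 φ)  ρ σ = (a : Univ G) → Sat G φ (extend a ρ) σ
Sat G (ex2 φ)   ρ σ = Σ (Univ G → Bool) (λ P → Sat G φ ρ (extend P σ))
Sat G (all2 φ)  ρ σ = (P : Univ G → Bool) → Sat G φ ρ (extend P σ)

pairEnv : {A : Set} → A → A → Fin 2 → A
pairEnv a b zero       = a
pairEnv a b (suc zero) = b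

GraphClass : Set₁
GraphClass = Graph → Set

MSO2Orderable : GraphClass → Set
MSO2Orderable C =
  Σ ℕ λ m → Σ (Formula 2 m) λ φ →
    (G : Graph) → C G → 0 < n G →
    Σ (Fin m → Univ G → Bool) λ P →
      IsTotalOrder {A = Univ G} _≡_ (λ a b → Sat G φ (pairEnv a b) P)

StepAvoid : (G : Graph) → Subset (n G) → Vertex G → Vertex G → Set
StepAvoid G S u v = T (adj G u v) × (u ∉ S) × (v ∉ S)

-- u and v lie in the same component of G - S (for u, v ∉ S)
ConnAvoid : (G : Graph) → Subset (n G) → Vertex G → Vertex G → Set
ConnAvoid G S = Star (StepAvoid G S)

-- G - S has exactly c connected components: there is a system of c
-- representatives, one in each component
HasComponents : (G : Graph) → Subset (n G) → ℕ → Set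
HasComponents G S c =
  Σ (Fin c → Vertex G) λ r →
    ((i : Fin c) → r i ∉ S) ×
    ((i j : Fin c) → ¬ (i ≡ j) → ¬ ConnAvoid G S (r i) (r j)) ×
    ((v : Vertex G) → v ∉ S → Σ (Fin c) λ i → ConnAvoid G S v (r i))

SepAtMost : Graph → ℕ → ℕ → Set
SepAtMost G k b =
  (S : Subset (n G)) → ∣ S ∣ ≤ k → (c : ℕ) → HasComponents G S c → c ≤ b

HasSEP : GraphClass → (ℕ → ℕ) → Set
HasSEP C f = (G : Graph) → C G → (k : ℕ) → SepAtMost G k (f k)

exp : ℕ → ℕ → ℕ
exp zero    x = x
exp (suc j) x = 2 ^ exp j x

Elementary : (ℕ → ℕ) → Set
Elementary f = Σ ℕ λ j → (x : ℕ) → f x ≤ exp j x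

module Submission where

-- Let φ(x, y; Z̄) order ⌈G⌉ and let S be a separator with |S| ≤ k.  Name the
-- vertices of S by constants and give each component of G − S the domain
-- consisting of its vertices, its edges and S.  For every such domain we
-- compute the depth-q Hintikka type ("code", q the quantifier depth of φ)
-- of its representative vertex, relative to the domain.  If two components
-- had equal codes, the back-and-forth argument on codes shows that
-- exchanging the two components preserves φ; then φ(a, b) and φ(b, a) would
-- both hold for their representatives, contradicting antisymmetry.  So the
-- number of components is at most the number of codes, a tower in k of
-- height depending only on φ.

open import Defs hiding (sym)
open import Data.Nat using (ℕ; zero; suc; _+_; _*_; _^_; _≤_; _<_; _⊔_; z≤n; s≤s; _≤?_; >-nonZero⁻¹)
open import Data.Nat.Properties
  using (≤-refl; ≤-trans; ≤-reflexive; <⇒≤; n≤1+n; m≤m+n; m≤n+m; m≤m⊔n; m≤n⊔m; +-mono-≤; +-monoʳ-≤; *-mono-≤; *-monoʳ-≤;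
         ^-monoʳ-≤; ^-distribˡ-+-*; ^-*-assoc; *-identityʳ; +-identityʳ; +-suc; +-assoc; module ≤-Reasoning)
open import Data.Nat.Tactic.RingSolver using (solve-∀)
open import Data.Bool using (Bool; true; false; T; not; _∧_; _∨_; if_then_else_)
open import Data.Bool.Properties using (∨-zeroʳ; ∧-conicalˡ; ∧-conicalʳ; not-injective; T-∧; T-irrelevant) renaming (_≟_ to _≟ᵇ_)
open import Data.Bool.ListAction using (any) renaming (or to disjunction)
open import Data.Empty using (⊥; ⊥-elim)
open import Data.Fin using (Fin; zero; suc)
open import Data.Fin.Properties using (injective⇒≤; nonZeroIndex) renaming (_≟_ to _≟ᶠ_)
open import Data.Fin.Subset using (Subset; _∈_; _∉_; ∣_∣; inside; outside)
open import Data.Fin.Subset.Properties using (_∈?_)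
open import Data.List using (List; []; _∷_; length; map; _++_; lookup; allFin; concatMap; cartesianProduct; cartesianProductWith)
open import Data.List.Properties using (length-++; length-map; map-cong)
open import Data.List.Membership.Propositional using () renaming (_∈_ to _∈ˡ_)
open import Data.List.Membership.Propositional.Properties
  using (∈-++⁺ˡ; ∈-++⁺ʳ; ∈-map⁺; ∈-concatMap⁺; ∈-allFin; ∈-cartesianProduct⁺; ∈-cartesianProductWith⁺)
open import Data.List.Relation.Unary.Any as Any using (here; there; index)
open import Data.List.Relation.Unary.Any.Properties using (lookup-index)
open import Data.Vec using (Vec; []; _∷_; tabulate; here; there) renaming (lookup to vlookup)
open import Data.Vec.Properties as Vec using (lookup∘tabulate; tabulate-cong)
open import Data.Maybe using (Maybe; just; nothing; is-just)
open import Data.Product using (Σ; _×_; _,_; proj₁; proj₂)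
open import Data.Product.Properties as Product using ()
open import Data.Sum using (_⊎_; inj₁; inj₂)
open import Data.Sum.Properties as Sum using (inj₁-injective)
open import Function using (_∘_)
open import Function.Bundles using (Equivalence)
open import Relation.Nullary using (¬_; Dec; yes; no; does)
open import Relation.Nullary.Decidable using (_⊎-dec_; T?; dec-true; dec-false; decidable-stable; ¬¬-excluded-middle)
open import Relation.Nullary.Negation using (¬¬-map)
open import Relation.Binary.Definitions using (DecidableEquality)
open import Relation.Binary.PropositionalEquality
  using (_≡_; refl; sym; trans; cong; cong₂; subst; subst₂; module ≡-Reasoning)
open import Relation.Binary.Structures using (IsTotalOrder)
open import Relation.Binary.Construct.Closure.ReflexiveTransitive using (ε; _◅_; _◅◅_; reverse)

dec-true⁻ : {A : Set} (a? : Dec A) → does a? ≡ true → A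
dec-true⁻ (yes a) _ = a

dec-false⁻ : {A : Set} (a? : Dec A) → does a? ≡ false → ¬ A
dec-false⁻ (no ¬a) _ = ¬a

∨-true-cases : ∀ a b → a ∨ b ≡ true → (a ≡ true) ⊎ (b ≡ true)
∨-true-cases true  b _      = inj₁ refl
∨-true-cases false b b-true = inj₂ b-true

∨-trueˡ : ∀ {a} b → a ≡ true → a ∨ b ≡ true
∨-trueˡ b refl = refl

∨-trueʳ : ∀ a {b} → b ≡ true → a ∨ b ≡ true
∨-trueʳ a refl = ∨-zeroʳ a

true≢false : ∀ {b} → b ≡ true → b ≡ false → ⊥
true≢false refl ()

any-intro : {A : Set} (p : A → Bool) {x : A} {xs : List A} → x ∈ˡ xs → p x ≡ true → any p xs ≡ true
any-intro p (here refl) px rewrite px = refl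
any-intro p {xs = y ∷ xs} (there x∈xs) px rewrite any-intro p x∈xs px = ∨-zeroʳ (p y)

any-witness : {A : Set} (p : A → Bool) (xs : List A) → any p xs ≡ true → Σ A λ x → p x ≡ true
any-witness p (x ∷ xs) found with p x in px
... | true  = x , px
... | false = any-witness p xs found

any-cong : {A : Set} {p q : A → Bool} → (∀ x → p x ≡ q x) → (xs : List A) → any p xs ≡ any q xs
any-cong p≗q xs = cong disjunction (map-cong p≗q xs)

-- A finite type: decidable equality together with a list containing
-- every element.  Types of codes are built from these, and their sizes
-- bound the number of components.
record Finite : Set₁ where
  field
    Carrier  : Set
    decEq    : DecidableEquality Carrier
    elements : List Carrier
    complete : (x : Carrier) → x ∈ˡ elements
open Finite public

size : Finite → ℕ
size A = length (elements A)

length-cartesianProductWith : {A B C : Set} (f : A → B → C) (xs : List A) (ys : List B) →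
  length (cartesianProductWith f xs ys) ≡ length xs * length ys
length-cartesianProductWith f [] ys = refl
length-cartesianProductWith f (x ∷ xs) ys = begin
  length (map (f x) ys ++ cartesianProductWith f xs ys)   ≡⟨ length-++ (map (f x) ys) ⟩
  length (map (f x) ys) + length (cartesianProductWith f xs ys)
    ≡⟨ cong₂ _+_ (length-map (f x) ys) (length-cartesianProductWith f xs ys) ⟩
  length ys + length xs * length ys                       ∎
  where open ≡-Reasoning

Boolᶠ : Finite
Boolᶠ = record { Carrier = Bool ; decEq = _≟ᵇ_ ; elements = false ∷ true ∷ [] ; complete = complete-Bool }
  where
  complete-Bool : (b : Bool) → b ∈ˡ (false ∷ true ∷ [])
  complete-Bool false = here refl
  complete-Bool true  = there (here refl)

_×ᶠ_ : Finite → Finite → Finite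
A ×ᶠ B = record
  { Carrier  = Carrier A × Carrier B
  ; decEq    = Product.≡-dec (decEq A) (decEq B)
  ; elements = cartesianProduct (elements A) (elements B)
  ; complete = λ (x , y) → ∈-cartesianProduct⁺ (complete A x) (complete B y)
  }

size-× : (A B : Finite) → size (A ×ᶠ B) ≡ size A * size B
size-× A B = length-cartesianProductWith _,_ (elements A) (elements B)

vectors : {A : Set} → List A → (n : ℕ) → List (Vec A n)
vectors xs zero    = [] ∷ []
vectors xs (suc n) = cartesianProductWith _∷_ xs (vectors xs n)

vectors-complete : {A : Set} {xs : List A} → ((x : A) → x ∈ˡ xs) → {n : ℕ} (v : Vec A n) → v ∈ˡ vectors xs n
vectors-complete all-in [] = here refl
vectors-complete all-in (x ∷ v) = ∈-cartesianProductWith⁺ _∷_ (all-in x) (vectors-complete all-in v)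

Vecᶠ : ℕ → Finite → Finite
Vecᶠ n A = record
  { Carrier  = Vec (Carrier A) n
  ; decEq    = Vec.≡-dec (decEq A)
  ; elements = vectors (elements A) n
  ; complete = vectors-complete (complete A)
  }

size-Vec : (n : ℕ) (A : Finite) → size (Vecᶠ n A) ≡ size A ^ n
size-Vec zero    A = refl
size-Vec (suc n) A = trans (length-cartesianProductWith _∷_ (elements A) (vectors (elements A) n))
                           (cong (size A *_) (size-Vec n A))

injection⇒≤size : (A : Finite) {c : ℕ} (f : Fin c → Carrier A) →
  (∀ i j → f i ≡ f j → i ≡ j) → c ≤ size A
injection⇒≤size A {c} f f-inj = injective⇒≤ {f = position} position-injective
  where
  position : Fin c → Fin (size A)
  position i = index (complete A (f i))
  position-injective : ∀ {i j} → position i ≡ position j → i ≡ j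
  position-injective {i} {j} same = f-inj i j (begin
    f i                            ≡⟨ lookup-index (complete A (f i)) ⟩
    lookup (elements A) (position i) ≡⟨ cong (lookup (elements A)) same ⟩
    lookup (elements A) (position j) ≡⟨ lookup-index (complete A (f j)) ⟨
    f j                            ∎)
    where open ≡-Reasoning

table : {a b : ℕ} → (Fin a → Fin b → Bool) → Vec (Vec Bool b) a
table f = tabulate (λ x → tabulate (f x))

row-entry : {A : Set} {a : ℕ} {f g : Fin a → A} → tabulate f ≡ tabulate g → ∀ x → f x ≡ g x
row-entry {f = f} {g} same x = trans (sym (lookup∘tabulate f x))
                                     (trans (cong (λ v → vlookup v x) same) (lookup∘tabulate g x))

table-entry : {a b : ℕ} {f g : Fin a → Fin b → Bool} → table f ≡ table g → ∀ x y → f x y ≡ g x y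
table-entry same x = row-entry (row-entry same x)

table-cong : {a b : ℕ} {f g : Fin a → Fin b → Bool} → (∀ x y → f x y ≡ g x y) → table f ≡ table g
table-cong f≗g = tabulate-cong (λ x → tabulate-cong (f≗g x))

-- The set of elements of a finite type C attained by f on a list, as a
-- characteristic vector along the enumeration of C.
realizes : {A : Set} (C : Finite) → (A → Carrier C) → List A → Vec Bool (size C)
realizes C f xs = tabulate (λ p → any (λ x → does (decEq C (f x) (lookup (elements C) p))) xs)

realizes-cong : {A : Set} (C : Finite) {f g : A → Carrier C} → (∀ x → f x ≡ g x) → (xs : List A) →
  realizes C f xs ≡ realizes C g xs
realizes-cong C f≗g xs = tabulate-cong (λ p → any-cong (λ x → cong (λ c → does (decEq C c _)) (f≗g x)) xs)

realizes-back : {A B : Set} (C : Finite) (f : A → Carrier C) (g : B → Carrier C) (xs : List A) (ys : List B) →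
  realizes C f xs ≡ realizes C g ys → {x : A} → x ∈ˡ xs → Σ B λ y → f x ≡ g y
realizes-back C f g xs ys same {x} x∈xs = y , trans fx≡c (sym (dec-true⁻ (decEq C (g y) c) gy≡c))
  where
  p = index (complete C (f x))
  c = lookup (elements C) p
  fx≡c : f x ≡ c
  fx≡c = lookup-index (complete C (f x))
  attained-by-g : any (λ z → does (decEq C (g z) c)) ys ≡ true
  attained-by-g = trans (sym (row-entry same p)) (any-intro _ x∈xs (dec-true (decEq C (f x) c) fx≡c))
  y = proj₁ (any-witness _ ys attained-by-g)
  gy≡c = proj₂ (any-witness _ ys attained-by-g)

-- Codes below evaluate quantifiers by searching these lists.
module IncidenceStructure (G : Graph) where

  U : Set
  U = Univ G

  _≟ᵉ_ : DecidableEquality (Edge G)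
  (p , x) ≟ᵉ (q , y) with Product.≡-dec _≟ᶠ_ _≟ᶠ_ p q
  ... | yes refl = yes (cong (p ,_) (T-irrelevant x y))
  ... | no p≢q   = no (λ same → p≢q (cong proj₁ same))

  _≟ᵘ_ : DecidableEquality U
  _≟ᵘ_ = Sum.≡-dec _≟ᶠ_ _≟ᵉ_

  inc? : (a b : U) → Dec (Inc G a b)
  inc? (inj₁ v) (inj₂ ((i , j) , _)) = (v ≟ᶠ i) ⊎-dec (v ≟ᶠ j)
  inc? (inj₁ _) (inj₁ _) = no λ ()
  inc? (inj₂ _) _        = no λ ()

  edgeAt : (p : Vertex G × Vertex G) → Dec (T (isEdge G p)) → List U
  edgeAt p (yes e) = inj₂ (p , e) ∷ []
  edgeAt p (no _)  = []

  edgeAt-complete : ∀ p (e : T (isEdge G p)) (e? : Dec (T (isEdge G p))) → inj₂ (p , e) ∈ˡ edgeAt p e?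
  edgeAt-complete p e (yes e′) = here (cong (λ z → inj₂ (p , z)) (T-irrelevant e e′))
  edgeAt-complete p e (no ¬e)  = ⊥-elim (¬e e)

  edgesAt : Vertex G × Vertex G → List U
  edgesAt p = edgeAt p (T? (isEdge G p))

  elementsU : List U
  elementsU = map inj₁ (allFin (n G)) ++ concatMap edgesAt (cartesianProduct (allFin (n G)) (allFin (n G)))

  elementsU-complete : (a : U) → a ∈ˡ elementsU
  elementsU-complete (inj₁ v) = ∈-++⁺ˡ (∈-map⁺ inj₁ (∈-allFin v))
  elementsU-complete (inj₂ ((i , j) , e)) = ∈-++⁺ʳ (map inj₁ (allFin (n G))) (∈-concatMap⁺ edgesAt
    (Any.map (λ { refl → edgeAt-complete (i , j) e (T? (isEdge G (i , j))) })
             (∈-cartesianProduct⁺ (∈-allFin i) (∈-allFin j))))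

  subsetOf : Vec Bool (length elementsU) → U → Bool
  subsetOf v a = vlookup v (index (elementsU-complete a))

  subsetsU : List (U → Bool)
  subsetsU = map subsetOf (elements (Vecᶠ (length elementsU) Boolᶠ))

  subsetsU-complete : (X : U → Bool) → Σ (U → Bool) λ Y → (Y ∈ˡ subsetsU) × (∀ a → X a ≡ Y a)
  subsetsU-complete X = subsetOf v , ∈-map⁺ subsetOf (complete (Vecᶠ _ Boolᶠ) v) , X≗Y
    where
    v = tabulate (λ p → X (lookup elementsU p))
    X≗Y : ∀ a → X a ≡ subsetOf v a
    X≗Y a = trans (cong X (lookup-index (elementsU-complete a)))
                  (sym (lookup∘tabulate (λ p → X (lookup elementsU p)) (index (elementsU-complete a))))

Bits : ℕ → Finite
Bits n = Vecᶠ n Boolᶠ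

Table : ℕ → ℕ → Finite
Table a b = Vecᶠ a (Bits b)

-- Atomic type of k element variables and m set variables over s constants:
-- which variables are defined, which variable equals which constant, the
-- memberships, equalities and incidences of variables, and the memberships
-- of the constants.
Atomᶠ : (s k m : ℕ) → Finite
Atomᶠ s k m = Bits k ×ᶠ (Table k s ×ᶠ (Table k m ×ᶠ (Table k k ×ᶠ (Table k k ×ᶠ Table s m))))

-- Codes of depth d (Hintikka types): the atomic type, and for d > 0 the sets
-- of codes of depth d - 1 reachable by adding an element or a set variable.
Codeᶠ : (s k m d : ℕ) → Finite
Codeᶠ s k m zero    = Atomᶠ s k m
Codeᶠ s k m (suc d) = Atomᶠ s k m ×ᶠ (Bits (size (Codeᶠ s (suc k) m d)) ×ᶠ Bits (size (Codeᶠ s k (suc m) d)))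

extend-pointwise : ∀ {k} {A : Set} (a : A) {ρ ρ′ : Fin k → A} → (∀ x → ρ x ≡ ρ′ x) →
  ∀ x → extend a ρ x ≡ extend a ρ′ x
extend-pointwise a ρ≗ρ′ zero    = refl
extend-pointwise a ρ≗ρ′ (suc x) = ρ≗ρ′ x

-- Codes of ⌈G⌉ relativized to a domain D ⊆ V ∪ E, with the vertices
-- core t as constants.  Element variables range over D (an element outside
-- D is recorded as `nothing`) and set variables are only seen inside D.
-- Equal codes of depth d + 1 allow one round of the back-and-forth game.
module RelativeTypes (G : Graph) {s : ℕ} (core : Fin s → Vertex G) where
  open IncidenceStructure G

  restrict : (D : U → Bool) → U → Maybe U
  restrict D a = if D a then just a else nothing

  isCore : Maybe U → Fin s → Bool
  isCore (just a) t = does (a ≟ᵘ inj₁ (core t))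
  isCore nothing  t = false

  memberOf : (D : U → Bool) → Maybe U → (U → Bool) → Bool
  memberOf D (just a) X = D a ∧ X a
  memberOf D nothing  X = false

  sameAs : Maybe U → Maybe U → Bool
  sameAs (just a) (just b) = does (a ≟ᵘ b)
  sameAs _        _        = false

  incidentTo : Maybe U → Maybe U → Bool
  incidentTo (just a) (just b) = does (inc? a b)
  incidentTo _        _        = false

  coreMemberOf : (D : U → Bool) → Fin s → (U → Bool) → Bool
  coreMemberOf D t X = D (inj₁ (core t)) ∧ X (inj₁ (core t))

  atom : ∀ {k m} (D : U → Bool) → (Fin k → Maybe U) → (Fin m → U → Bool) → Carrier (Atomᶠ s k m)
  atom D ρ σ = tabulate (λ x → is-just (ρ x)) , table (λ x → isCore (ρ x)) ,
    table (λ x Z → memberOf D (ρ x) (σ Z)) , table (λ x y → sameAs (ρ x) (ρ y)) ,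
    table (λ x y → incidentTo (ρ x) (ρ y)) , table (λ t Z → coreMemberOf D t (σ Z))

  code : (D : U → Bool) (d : ℕ) {k m : ℕ} → (Fin k → Maybe U) → (Fin m → U → Bool) → Carrier (Codeᶠ s k m d)
  code D zero          ρ σ = atom D ρ σ
  code D (suc d) {k} {m} ρ σ = atom D ρ σ ,
    realizes (Codeᶠ s (suc k) m d) (λ a → code D d (extend (restrict D a) ρ) σ) elementsU ,
    realizes (Codeᶠ s k (suc m) d) (λ X → code D d ρ (extend X σ)) subsetsU

  atom-≡ : ∀ {D D′} d {k m} {ρ ρ′ : Fin k → Maybe U} {σ σ′ : Fin m → U → Bool} →
    code D d ρ σ ≡ code D′ d ρ′ σ′ → atom D ρ σ ≡ atom D′ ρ′ σ′
  atom-≡ zero    same = same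
  atom-≡ (suc d) same = cong proj₁ same

  AgreeOn : ∀ {m} → (U → Bool) → (Fin m → U → Bool) → (Fin m → U → Bool) → Set
  AgreeOn D σ σ′ = ∀ Z a → D a ≡ true → σ Z a ≡ σ′ Z a

  extend-agrees : ∀ {m} {D} (X : U → Bool) {σ σ′ : Fin m → U → Bool} → AgreeOn D σ σ′ →
    AgreeOn D (extend X σ) (extend X σ′)
  extend-agrees X σ≈σ′ zero    a _ = refl
  extend-agrees X σ≈σ′ (suc Z) a = σ≈σ′ Z a

  memberOf-cong : ∀ D mb X Y → (∀ a → D a ≡ true → X a ≡ Y a) → memberOf D mb X ≡ memberOf D mb Y
  memberOf-cong D (just a) X Y X≈Y with D a in Da
  ... | true  = X≈Y a Da
  ... | false = refl
  memberOf-cong D nothing X Y X≈Y = refl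

  coreMemberOf-cong : ∀ D t X Y → (∀ a → D a ≡ true → X a ≡ Y a) → coreMemberOf D t X ≡ coreMemberOf D t Y
  coreMemberOf-cong D t X Y X≈Y with D (inj₁ (core t)) in Dc
  ... | true  = X≈Y _ Dc
  ... | false = refl

  atom-cong : ∀ D {k m} {ρ ρ′ : Fin k → Maybe U} {σ σ′ : Fin m → U → Bool} →
    (∀ x → ρ x ≡ ρ′ x) → AgreeOn D σ σ′ → atom D ρ σ ≡ atom D ρ′ σ′
  atom-cong D {ρ′ = ρ′} {σ} {σ′} ρ≗ρ′ σ≈σ′ =
    cong₂ _,_ (tabulate-cong (λ x → cong is-just (ρ≗ρ′ x)))
    (cong₂ _,_ (table-cong (λ x t → cong (λ z → isCore z t) (ρ≗ρ′ x)))
    (cong₂ _,_ (table-cong (λ x Z → trans (cong (λ z → memberOf D z (σ Z)) (ρ≗ρ′ x))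
                                          (memberOf-cong D (ρ′ x) (σ Z) (σ′ Z) (σ≈σ′ Z))))
    (cong₂ _,_ (table-cong (λ x y → cong₂ sameAs (ρ≗ρ′ x) (ρ≗ρ′ y)))
    (cong₂ _,_ (table-cong (λ x y → cong₂ incidentTo (ρ≗ρ′ x) (ρ≗ρ′ y)))
               (table-cong (λ t Z → coreMemberOf-cong D t (σ Z) (σ′ Z) (σ≈σ′ Z)))))))

  code-cong : ∀ D d {k m} {ρ ρ′ : Fin k → Maybe U} {σ σ′ : Fin m → U → Bool} →
    (∀ x → ρ x ≡ ρ′ x) → AgreeOn D σ σ′ → code D d ρ σ ≡ code D d ρ′ σ′
  code-cong D zero ρ≗ρ′ σ≈σ′ = atom-cong D ρ≗ρ′ σ≈σ′
  code-cong D (suc d) {k} {m} ρ≗ρ′ σ≈σ′ = cong₂ _,_ (atom-cong D ρ≗ρ′ σ≈σ′) (cong₂ _,_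
    (realizes-cong (Codeᶠ s (suc k) m d) (λ a → code-cong D d (extend-pointwise (restrict D a) ρ≗ρ′) σ≈σ′) elementsU)
    (realizes-cong (Codeᶠ s k (suc m) d) (λ X → code-cong D d ρ≗ρ′ (extend-agrees X σ≈σ′)) subsetsU))

  module AtomAgreement {D D′ : U → Bool} {k m} {ρ ρ′ : Fin k → Maybe U} {σ σ′ : Fin m → U → Bool}
                       (same : atom D ρ σ ≡ atom D′ ρ′ σ′) where
    defined-agrees : ∀ x → is-just (ρ x) ≡ is-just (ρ′ x)
    defined-agrees = row-entry (cong proj₁ same)
    isCore-agrees : ∀ x t → isCore (ρ x) t ≡ isCore (ρ′ x) t
    isCore-agrees = table-entry (cong (proj₁ ∘ proj₂) same)
    memberOf-agrees : ∀ x Z → memberOf D (ρ x) (σ Z) ≡ memberOf D′ (ρ′ x) (σ′ Z)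
    memberOf-agrees = table-entry (cong (proj₁ ∘ proj₂ ∘ proj₂) same)
    sameAs-agrees : ∀ x y → sameAs (ρ x) (ρ y) ≡ sameAs (ρ′ x) (ρ′ y)
    sameAs-agrees = table-entry (cong (proj₁ ∘ proj₂ ∘ proj₂ ∘ proj₂) same)
    incidentTo-agrees : ∀ x y → incidentTo (ρ x) (ρ y) ≡ incidentTo (ρ′ x) (ρ′ y)
    incidentTo-agrees = table-entry (cong (proj₁ ∘ proj₂ ∘ proj₂ ∘ proj₂ ∘ proj₂) same)
    coreMemberOf-agrees : ∀ t Z → coreMemberOf D t (σ Z) ≡ coreMemberOf D′ t (σ′ Z)
    coreMemberOf-agrees = table-entry (cong (proj₂ ∘ proj₂ ∘ proj₂ ∘ proj₂ ∘ proj₂) same)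

  back-element : ∀ D D′ d {k m} (ρ ρ′ : Fin k → Maybe U) (σ σ′ : Fin m → U → Bool) →
    code D (suc d) ρ σ ≡ code D′ (suc d) ρ′ σ′ → (a : U) →
    Σ U λ a′ → code D d (extend (restrict D a) ρ) σ ≡ code D′ d (extend (restrict D′ a′) ρ′) σ′
  back-element D D′ d {k} {m} ρ ρ′ σ σ′ same a =
    realizes-back (Codeᶠ s (suc k) m d) (λ b → code D d (extend (restrict D b) ρ) σ)
      (λ b → code D′ d (extend (restrict D′ b) ρ′) σ′) elementsU elementsU
      (cong (proj₁ ∘ proj₂) same) (elementsU-complete a)

  back-set : ∀ D D′ d {k m} (ρ ρ′ : Fin k → Maybe U) (σ σ′ : Fin m → U → Bool) →
    code D (suc d) ρ σ ≡ code D′ (suc d) ρ′ σ′ → (X : U → Bool) →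
    Σ (U → Bool) λ Y → code D d ρ (extend X σ) ≡ code D′ d ρ′ (extend Y σ′)
  back-set D D′ d {k} {m} ρ ρ′ σ σ′ same X = Y , trans X-as-listed X′≡Y
    where
    listed = subsetsU-complete X
    X′ = proj₁ listed
    X-as-listed : code D d ρ (extend X σ) ≡ code D d ρ (extend X′ σ)
    X-as-listed = code-cong D d (λ _ → refl) λ { zero a _ → proj₂ (proj₂ listed) a ; (suc Z) a _ → refl }
    answer = realizes-back (Codeᶠ s k (suc m) d) (λ Z → code D d ρ (extend Z σ))
      (λ Z → code D′ d ρ′ (extend Z σ′)) subsetsU subsetsU (cong (proj₂ ∘ proj₂) same) (proj₁ (proj₂ listed))
    Y = proj₁ answer
    X′≡Y = proj₂ answer

  restrict-in : ∀ D a → D a ≡ true → restrict D a ≡ just a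
  restrict-in D a Da rewrite Da = refl

  restrict-out : ∀ D a → D a ≡ false → restrict D a ≡ nothing
  restrict-out D a Da rewrite Da = refl

  is-just-restrict : ∀ D a → is-just (restrict D a) ≡ D a
  is-just-restrict D a with D a
  ... | true  = refl
  ... | false = refl

  module NewElement {D D′ : U → Bool} d {k m} {ρ ρ′ : Fin k → Maybe U} {σ σ′ : Fin m → U → Bool} {a a′ : U}
    (same : code D d (extend (restrict D a) ρ) σ ≡ code D′ d (extend (restrict D′ a′) ρ′) σ′) where
    open AtomAgreement {ρ = extend (restrict D a) ρ} {extend (restrict D′ a′) ρ′} {σ} {σ′} (atom-≡ d same)

    domain-agrees : D a ≡ D′ a′
    domain-agrees = trans (sym (is-just-restrict D a)) (trans (defined-agrees zero) (is-just-restrict D′ a′))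

    constant-agrees : D a ≡ true → ∀ t → a ≡ inj₁ (core t) → a′ ≡ inj₁ (core t)
    constant-agrees Da t a≡c = dec-true⁻ (a′ ≟ᵘ inj₁ (core t)) (begin
      isCore (just a′) t          ≡⟨ cong (λ z → isCore z t) (restrict-in D′ a′ (trans (sym domain-agrees) Da)) ⟨
      isCore (restrict D′ a′) t   ≡⟨ isCore-agrees zero t ⟨
      isCore (restrict D a) t     ≡⟨ cong (λ z → isCore z t) (restrict-in D a Da) ⟩
      isCore (just a) t           ≡⟨ dec-true (a ≟ᵘ inj₁ (core t)) a≡c ⟩
      true                        ∎)
      where open ≡-Reasoning

  back-inside : ∀ D D′ d {k m} (ρ ρ′ : Fin k → Maybe U) (σ σ′ : Fin m → U → Bool) →
    code D (suc d) ρ σ ≡ code D′ (suc d) ρ′ σ′ → (a : U) → D a ≡ true →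
    Σ U λ a′ → (code D d (extend (restrict D a) ρ) σ ≡ code D′ d (extend (restrict D′ a′) ρ′) σ′) ×
      (D′ a′ ≡ true) × (∀ t → a′ ≡ inj₁ (core t) → a ≡ inj₁ (core t))
  back-inside D D′ d ρ ρ′ σ σ′ same a Da = a′ , answers , D′a′ , λ t → NewElement.constant-agrees d (sym answers) D′a′ t
    where
    a′ = proj₁ (back-element D D′ d ρ ρ′ σ σ′ same a)
    answers = proj₂ (back-element D D′ d ρ ρ′ σ σ′ same a)
    D′a′ = trans (sym (NewElement.domain-agrees d answers)) Da

  back-outside : ∀ D D′ d {k m} (ρ ρ′ : Fin k → Maybe U) (σ σ′ : Fin m → U → Bool) →
    code D (suc d) ρ σ ≡ code D′ (suc d) ρ′ σ′ → (a a′ : U) → D a ≡ false → D′ a′ ≡ false →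
    code D d (extend (restrict D a) ρ) σ ≡ code D′ d (extend (restrict D′ a′) ρ′) σ′
  back-outside D D′ d ρ ρ′ σ σ′ same a a′ Da D′a′ =
    trans answers (cong (λ z → code D′ d (extend z ρ′) σ′) (trans (restrict-out D′ b D′b) (sym (restrict-out D′ a′ D′a′))))
    where
    b = proj₁ (back-element D D′ d ρ ρ′ σ σ′ same a)
    answers = proj₂ (back-element D D′ d ρ ρ′ σ σ′ same a)
    D′b = trans (sym (NewElement.domain-agrees d answers)) Da

  back-fixed : ∀ D D′ d {k m} (ρ ρ′ : Fin k → Maybe U) (σ σ′ : Fin m → U → Bool) →
    code D (suc d) ρ σ ≡ code D′ (suc d) ρ′ σ′ → (a : U) → D a ≡ D′ a →
    (D a ≡ true → Σ (Fin s) λ t → a ≡ inj₁ (core t)) →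
    code D d (extend (restrict D a) ρ) σ ≡ code D′ d (extend (restrict D′ a) ρ′) σ′
  back-fixed D D′ d ρ ρ′ σ σ′ same a Da≡D′a constant =
    trans answers (cong (λ z → code D′ d (extend z ρ′) σ′) (same-restriction (D a) refl))
    where
    b = proj₁ (back-element D D′ d ρ ρ′ σ σ′ same a)
    answers = proj₂ (back-element D D′ d ρ ρ′ σ σ′ same a)
    same-restriction : (x : Bool) → D a ≡ x → restrict D′ b ≡ restrict D′ a
    same-restriction false Da = trans (restrict-out D′ b (trans (sym (NewElement.domain-agrees d answers)) Da))
                                      (sym (restrict-out D′ a (trans (sym Da≡D′a) Da)))
    same-restriction true Da = cong (restrict D′) (trans (NewElement.constant-agrees d answers Da t a≡c) (sym a≡c))
      where
      t = proj₁ (constant Da)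
      a≡c = proj₂ (constant Da)

  agree-on-constants : ∀ D D′ d {k m} (ρ ρ′ : Fin k → Maybe U) (σ σ′ : Fin m → U → Bool) (X Y : U → Bool) →
    code D d ρ (extend X σ) ≡ code D′ d ρ′ (extend Y σ′) → ∀ t →
    D (inj₁ (core t)) ≡ true → D′ (inj₁ (core t)) ≡ true → X (inj₁ (core t)) ≡ Y (inj₁ (core t))
  agree-on-constants D D′ d ρ ρ′ σ σ′ X Y same t Dc D′c = begin
    X c           ≡⟨ cong (_∧ X c) Dc ⟨
    D c ∧ X c     ≡⟨ coreMemberOf-agrees t zero ⟩
    D′ c ∧ Y c    ≡⟨ cong (_∧ Y c) D′c ⟩
    Y c           ∎
    where
    open ≡-Reasoning
    open AtomAgreement {ρ = ρ} {ρ′} {extend X σ} {extend Y σ′} (atom-≡ d same)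
    c = inj₁ (core t)

  local : ∀ {k} → (U → Bool) → (Fin k → U) → Fin k → Maybe U
  local D ρ x = restrict D (ρ x)

  local-extend : ∀ D d {k m} (a : U) (ρ : Fin k → U) (σ : Fin m → U → Bool) →
    code D d (local D (extend a ρ)) σ ≡ code D d (extend (restrict D a) (local D ρ)) σ
  local-extend D d a ρ σ = code-cong D d (λ { zero → refl ; (suc x) → refl }) (λ _ _ _ → refl)

  module AtomTransfer {D D′ : U → Bool} {k m} {ρ ρ′ : Fin k → U} {σ σ′ : Fin m → U → Bool}
                      (same : atom D (local D ρ) σ ≡ atom D′ (local D′ ρ′) σ′) where
    open AtomAgreement same

    domain-transfer : ∀ x → D (ρ x) ≡ true → D′ (ρ′ x) ≡ true
    domain-transfer x Dx = trans (sym (is-just-restrict D′ (ρ′ x)))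
                                 (trans (sym (defined-agrees x)) (trans (is-just-restrict D (ρ x)) Dx))

    relation-transfer : {R : U → U → Set} (R? : ∀ a b → Dec (R a b)) (f : Maybe U → Maybe U → Bool) →
      (∀ a b → f (just a) (just b) ≡ does (R? a b)) →
      (∀ x y → f (local D ρ x) (local D ρ y) ≡ f (local D′ ρ′ x) (local D′ ρ′ y)) →
      ∀ x y → D (ρ x) ≡ true → D (ρ y) ≡ true → R (ρ x) (ρ y) → R (ρ′ x) (ρ′ y)
    relation-transfer R? f f-just agrees x y Dx Dy Rxy = dec-true⁻ (R? (ρ′ x) (ρ′ y)) (begin
      does (R? (ρ′ x) (ρ′ y))                   ≡⟨ f-just (ρ′ x) (ρ′ y) ⟨
      f (just (ρ′ x)) (just (ρ′ y))             ≡⟨ cong₂ f (restrict-in D′ _ (domain-transfer x Dx))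
                                                          (restrict-in D′ _ (domain-transfer y Dy)) ⟨
      f (local D′ ρ′ x) (local D′ ρ′ y)         ≡⟨ agrees x y ⟨
      f (local D ρ x) (local D ρ y)             ≡⟨ cong₂ f (restrict-in D _ Dx) (restrict-in D _ Dy) ⟩
      f (just (ρ x)) (just (ρ y))               ≡⟨ f-just (ρ x) (ρ y) ⟩
      does (R? (ρ x) (ρ y))                     ≡⟨ dec-true (R? (ρ x) (ρ y)) Rxy ⟩
      true                                      ∎)
      where open ≡-Reasoning

    incidence-transfer : ∀ x y → D (ρ x) ≡ true → D (ρ y) ≡ true → Inc G (ρ x) (ρ y) → Inc G (ρ′ x) (ρ′ y)
    incidence-transfer = relation-transfer inc? incidentTo (λ _ _ → refl) incidentTo-agrees

    equality-transfer : ∀ x y → D (ρ x) ≡ true → D (ρ y) ≡ true → ρ x ≡ ρ y → ρ′ x ≡ ρ′ y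
    equality-transfer = relation-transfer _≟ᵘ_ sameAs (λ _ _ → refl) sameAs-agrees

    membership-transfer : ∀ x Z → D (ρ x) ≡ true → σ Z (ρ x) ≡ σ′ Z (ρ′ x)
    membership-transfer x Z Dx = begin
      σ Z (ρ x)                           ≡⟨ cong (_∧ σ Z (ρ x)) Dx ⟨
      D (ρ x) ∧ σ Z (ρ x)                 ≡⟨ cong (λ z → memberOf D z (σ Z)) (restrict-in D _ Dx) ⟨
      memberOf D (local D ρ x) (σ Z)      ≡⟨ memberOf-agrees x Z ⟩
      memberOf D′ (local D′ ρ′ x) (σ′ Z)  ≡⟨ cong (λ z → memberOf D′ z (σ′ Z)) (restrict-in D′ _ D′x) ⟩
      D′ (ρ′ x) ∧ σ′ Z (ρ′ x)             ≡⟨ cong (_∧ σ′ Z (ρ′ x)) D′x ⟩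
      σ′ Z (ρ′ x)                         ∎
      where
      open ≡-Reasoning
      D′x = domain-transfer x Dx

-- Distinct components own disjoint parts of ⌈G⌉, and incidence never
-- leaves a domain: the facts that make swapping two components harmless.
module Components (G : Graph) (S : Subset (n G)) {c : ℕ} (r : Fin c → Vertex G)
  (separated : ∀ i j → ¬ i ≡ j → ¬ ConnAvoid G S (r i) (r j))
  (reaches? : ∀ i v → Dec (ConnAvoid G S v (r i))) where
  open IncidenceStructure G

  inSeparator : Vertex G → Bool
  inSeparator v = does (v ∈? S)

  inComponentᵛ : Fin c → Vertex G → Bool
  inComponentᵛ i v = not (inSeparator v) ∧ does (reaches? i v)

  inComponent : Fin c → U → Bool
  inComponent i (inj₁ v)            = inComponentᵛ i v
  inComponent i (inj₂ ((u , w) , _)) = inComponentᵛ i u ∨ inComponentᵛ i w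

  separatorVertex : U → Bool
  separatorVertex (inj₁ v) = inSeparator v
  separatorVertex (inj₂ _) = false

  domain : Fin c → U → Bool
  domain i a = inComponent i a ∨ separatorVertex a

  inComponentᵛ-elim : ∀ i v → inComponentᵛ i v ≡ true → (v ∉ S) × ConnAvoid G S v (r i)
  inComponentᵛ-elim i v owned = dec-false⁻ (v ∈? S) (not-injective (∧-conicalˡ _ _ owned)) ,
                                 dec-true⁻ (reaches? i v) (∧-conicalʳ _ _ owned)

  inComponentᵛ-intro : ∀ i v → v ∉ S → ConnAvoid G S v (r i) → inComponentᵛ i v ≡ true
  inComponentᵛ-intro i v v∉S reach rewrite dec-false (v ∈? S) v∉S | dec-true (reaches? i v) reach = refl

  representative-inside : ∀ i → r i ∉ S → inComponent i (inj₁ (r i)) ≡ true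
  representative-inside i ri∉S = inComponentᵛ-intro i (r i) ri∉S ε

  edge-adjacent : ∀ u w → T (isEdge G (u , w)) → T (adj G u w)
  edge-adjacent u w e = proj₂ (Equivalence.to T-∧ e)

  step-sym : ∀ {u v} → StepAvoid G S u v → StepAvoid G S v u
  step-sym {u} {v} (uv , u∉S , v∉S) = subst T (Graph.sym G u v) uv , v∉S , u∉S

  adjacent-inside : ∀ i u v → T (adj G u v) → u ∉ S → inComponentᵛ i v ≡ true → inComponentᵛ i u ≡ true
  adjacent-inside i u v uv u∉S v-inside =
    inComponentᵛ-intro i u u∉S ((uv , u∉S , proj₁ (inComponentᵛ-elim i v v-inside)) ◅ proj₂ (inComponentᵛ-elim i v v-inside))

  disjointᵛ : ∀ i j → ¬ i ≡ j → ∀ v → inComponentᵛ i v ≡ true → inComponentᵛ j v ≡ true → ⊥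
  disjointᵛ i j i≢j v in-i in-j =
    separated i j i≢j (reverse step-sym (proj₂ (inComponentᵛ-elim i v in-i)) ◅◅ proj₂ (inComponentᵛ-elim j v in-j))

  disjoint : ∀ i j → ¬ i ≡ j → ∀ a → inComponent i a ≡ true → inComponent j a ≡ false
  disjoint i j i≢j a in-i with inComponent j a in in-j
  ... | false = refl
  ... | true  = ⊥-elim (clash a in-i in-j)
    where
    clash : ∀ a → inComponent i a ≡ true → inComponent j a ≡ true → ⊥
    clash (inj₁ v) in-i in-j = disjointᵛ i j i≢j v in-i in-j
    clash (inj₂ ((u , w) , e)) in-i in-j with ∨-true-cases _ _ in-i | ∨-true-cases _ _ in-j
    ... | inj₁ u-i | inj₁ u-j = disjointᵛ i j i≢j u u-i u-j
    ... | inj₂ w-i | inj₂ w-j = disjointᵛ i j i≢j w w-i w-j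
    ... | inj₁ u-i | inj₂ w-j =
      disjointᵛ i j i≢j u u-i (adjacent-inside j u w (edge-adjacent u w e) (proj₁ (inComponentᵛ-elim i u u-i)) w-j)
    ... | inj₂ w-i | inj₁ u-j =
      disjointᵛ i j i≢j u (adjacent-inside i u w (edge-adjacent u w e) (proj₁ (inComponentᵛ-elim j u u-j)) w-i) u-j

  inside⇒not-separator : ∀ i a → inComponent i a ≡ true → separatorVertex a ≡ false
  inside⇒not-separator i (inj₁ v) owned = not-injective (∧-conicalˡ _ _ owned)
  inside⇒not-separator i (inj₂ _) owned = refl

  separator⇒outside : ∀ i a → separatorVertex a ≡ true → inComponent i a ≡ false
  separator⇒outside i a sep with inComponent i a in owned
  ... | false = refl
  ... | true  = ⊥-elim (true≢false sep (inside⇒not-separator i a owned))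

  inside⇒domain : ∀ i a → inComponent i a ≡ true → domain i a ≡ true
  inside⇒domain i a = ∨-trueˡ (separatorVertex a)

  incident-domainʳ : ∀ i a b → Inc G a b → inComponent i a ≡ true → domain i b ≡ true
  incident-domainʳ i (inj₁ v) (inj₂ ((u , w) , _)) (inj₁ refl) owned = ∨-trueˡ false (∨-trueˡ (inComponentᵛ i w) owned)
  incident-domainʳ i (inj₁ v) (inj₂ ((u , w) , _)) (inj₂ refl) owned = ∨-trueˡ false (∨-trueʳ (inComponentᵛ i u) owned)

  incident-domainˡ : ∀ i a b → Inc G a b → inComponent i b ≡ true → domain i a ≡ true
  incident-domainˡ i (inj₁ v) (inj₂ ((u , w) , e)) v-ends owned = separator-or-inside (v ∈? S)
    where
    endpoint-inside : v ∉ S → (v ≡ u) ⊎ (v ≡ w) → (inComponentᵛ i u ≡ true) ⊎ (inComponentᵛ i w ≡ true) →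
      inComponentᵛ i v ≡ true
    endpoint-inside v∉S (inj₁ refl) (inj₁ u-i) = u-i
    endpoint-inside v∉S (inj₂ refl) (inj₂ w-i) = w-i
    endpoint-inside v∉S (inj₁ refl) (inj₂ w-i) = adjacent-inside i v w (edge-adjacent v w e) v∉S w-i
    endpoint-inside v∉S (inj₂ refl) (inj₁ u-i) = adjacent-inside i v u (subst T (Graph.sym G u v) (edge-adjacent u v e)) v∉S u-i
    separator-or-inside : Dec (v ∈ S) → domain i (inj₁ v) ≡ true
    separator-or-inside (yes v∈S) = ∨-trueʳ (inComponentᵛ i v) (dec-true (v ∈? S) v∈S)
    separator-or-inside (no v∉S)  = ∨-trueˡ (inSeparator v) (endpoint-inside v∉S v-ends (∨-true-cases _ _ owned))

  outside-domain : ∀ i j → ¬ i ≡ j → ∀ a → inComponent i a ≡ true → domain j a ≡ false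
  outside-domain i j i≢j a owned = cong₂ _∨_ (disjoint i j i≢j a owned) (inside⇒not-separator i a owned)

depth : ∀ {k m} → Formula k m → ℕ
depth (inc _ _)  = 0
depth (eq _ _)   = 0
depth (mem _ _)  = 0
depth (neg φ)    = depth φ
depth (and φ ψ)  = depth φ ⊔ depth ψ
depth (or φ ψ)   = depth φ ⊔ depth ψ
depth (ex1 φ)    = suc (depth φ)
depth (all1 φ)   = suc (depth φ)
depth (ex2 φ)    = suc (depth φ)
depth (all2 φ)   = suc (depth φ)

-- The separator S is named by the
-- constants core t.  A position of the back-and-forth game between
-- (ρ, σ) and (ρ′, σ′) is a swap of components i ≠ j at depth d when ρ′
-- exchanges the roles of i and j, both sides agree outside i and j, and
-- the depth-d codes seen from the domain of i on one side equal those seen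
-- from the domain of j on the other (and vice versa).
module Swap (G : Graph) (S : Subset (n G)) {c : ℕ} (r : Fin c → Vertex G)
  (separated : ∀ i j → ¬ i ≡ j → ¬ ConnAvoid G S (r i) (r j))
  (reaches? : ∀ i v → Dec (ConnAvoid G S v (r i)))
  {s : ℕ} (core : Fin s → Vertex G) (core∈S : ∀ t → core t ∈ S)
  (core-onto : ∀ v → v ∈ S → Σ (Fin s) λ t → core t ≡ v) where
  open IncidenceStructure G
  open Components G S r separated reaches?
  open RelativeTypes G core

  separator-constant : ∀ a → separatorVertex a ≡ true → Σ (Fin s) λ t → a ≡ inj₁ (core t)
  separator-constant (inj₁ v) v∈S = proj₁ named , cong inj₁ (sym (proj₂ named))
    where named = core-onto v (dec-true⁻ (v ∈? S) v∈S)

  constant-separator : ∀ t → separatorVertex (inj₁ (core t)) ≡ true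
  constant-separator t = dec-true (core t ∈? S) (core∈S t)

  constant-in-domain : ∀ i t → domain i (inj₁ (core t)) ≡ true
  constant-in-domain i t = ∨-trueʳ (inComponentᵛ i (core t)) (constant-separator t)

  record Swapped (i j : Fin c) (d : ℕ) {k m : ℕ} (ρ ρ′ : Fin k → U) (σ σ′ : Fin m → U → Bool) : Set where
    field
      i↦j : ∀ x → inComponent i (ρ x) ≡ inComponent j (ρ′ x)
      j↦i : ∀ x → inComponent j (ρ x) ≡ inComponent i (ρ′ x)
      fixes-elements : ∀ x → inComponent i (ρ x) ≡ false → inComponent j (ρ x) ≡ false → ρ′ x ≡ ρ x
      fixes-sets : ∀ Z a → inComponent i a ≡ false → inComponent j a ≡ false → σ′ Z a ≡ σ Z a
      codeᵢ≡codeⱼ : code (domain i) d (local (domain i) ρ) σ ≡ code (domain j) d (local (domain j) ρ′) σ′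
      codeⱼ≡codeᵢ : code (domain j) d (local (domain j) ρ) σ ≡ code (domain i) d (local (domain i) ρ′) σ′
  open Swapped

  swap-roles : ∀ {i j d k m} {ρ ρ′ : Fin k → U} {σ σ′ : Fin m → U → Bool} →
    Swapped i j d ρ ρ′ σ σ′ → Swapped j i d ρ ρ′ σ σ′
  swap-roles sw = record
    { i↦j = j↦i sw ; j↦i = i↦j sw
    ; fixes-elements = λ x out-j out-i → fixes-elements sw x out-i out-j
    ; fixes-sets = λ Z a out-j out-i → fixes-sets sw Z a out-i out-j
    ; codeᵢ≡codeⱼ = codeⱼ≡codeᵢ sw ; codeⱼ≡codeᵢ = codeᵢ≡codeⱼ sw }

  swap-sides : ∀ {i j d k m} {ρ ρ′ : Fin k → U} {σ σ′ : Fin m → U → Bool} →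
    Swapped i j d ρ ρ′ σ σ′ → Swapped i j d ρ′ ρ σ′ σ
  swap-sides sw = record
    { i↦j = λ x → sym (j↦i sw x) ; j↦i = λ x → sym (i↦j sw x)
    ; fixes-elements = λ x out-i out-j → sym (fixes-elements sw x (trans (i↦j sw x) out-j) (trans (j↦i sw x) out-i))
    ; fixes-sets = λ Z a out-i out-j → sym (fixes-sets sw Z a out-i out-j)
    ; codeᵢ≡codeⱼ = sym (codeⱼ≡codeᵢ sw) ; codeⱼ≡codeᵢ = sym (codeᵢ≡codeⱼ sw) }

  data Position (i j : Fin c) (a : U) : Set where
    in-i      : inComponent i a ≡ true → Position i j a
    in-j      : inComponent j a ≡ true → Position i j a
    elsewhere : inComponent i a ≡ false → inComponent j a ≡ false → Position i j a

  position : ∀ i j a → Position i j a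
  position i j a with inComponent i a in a-i | inComponent j a in a-j
  ... | true  | _     = in-i a-i
  ... | false | true  = in-j a-j
  ... | false | false = elsewhere a-i a-j

  module FromSwap {i j d k m} {ρ ρ′ : Fin k → U} {σ σ′ : Fin m → U → Bool} (sw : Swapped i j d ρ ρ′ σ σ′) where
    module Viaᵢ = AtomTransfer {domain i} {domain j} {ρ = ρ} {ρ′} {σ} {σ′} (atom-≡ d (codeᵢ≡codeⱼ sw))
    module Viaⱼ = AtomTransfer {domain j} {domain i} {ρ = ρ} {ρ′} {σ} {σ′} (atom-≡ d (codeⱼ≡codeᵢ sw))

  incidence-preserved : ∀ {i j d k m} {ρ ρ′ : Fin k → U} {σ σ′ : Fin m → U → Bool} → Swapped i j d ρ ρ′ σ σ′ →
    ∀ x y → Inc G (ρ x) (ρ y) → Inc G (ρ′ x) (ρ′ y)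
  incidence-preserved {i} {j} {ρ = ρ} sw x y xy with position i j (ρ x)
  ... | in-i x-i = FromSwap.Viaᵢ.incidence-transfer sw x y (inside⇒domain i (ρ x) x-i) (incident-domainʳ i (ρ x) (ρ y) xy x-i) xy
  ... | in-j x-j = FromSwap.Viaⱼ.incidence-transfer sw x y (inside⇒domain j (ρ x) x-j) (incident-domainʳ j (ρ x) (ρ y) xy x-j) xy
  ... | elsewhere x-i x-j with position i j (ρ y)
  ...   | in-i y-i = FromSwap.Viaᵢ.incidence-transfer sw x y (incident-domainˡ i (ρ x) (ρ y) xy y-i) (inside⇒domain i (ρ y) y-i) xy
  ...   | in-j y-j = FromSwap.Viaⱼ.incidence-transfer sw x y (incident-domainˡ j (ρ x) (ρ y) xy y-j) (inside⇒domain j (ρ y) y-j) xy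
  ...   | elsewhere y-i y-j =
    subst₂ (Inc G) (sym (fixes-elements sw x x-i x-j)) (sym (fixes-elements sw y y-i y-j)) xy

  equality-preserved : ∀ {i j d k m} {ρ ρ′ : Fin k → U} {σ σ′ : Fin m → U → Bool} → Swapped i j d ρ ρ′ σ σ′ →
    ∀ x y → ρ x ≡ ρ y → ρ′ x ≡ ρ′ y
  equality-preserved {i} {j} {ρ = ρ} sw x y x≡y with position i j (ρ x)
  ... | in-i x-i = FromSwap.Viaᵢ.equality-transfer sw x y (inside⇒domain i (ρ x) x-i)
                     (inside⇒domain i (ρ y) (subst (λ a → inComponent i a ≡ true) x≡y x-i)) x≡y
  ... | in-j x-j = FromSwap.Viaⱼ.equality-transfer sw x y (inside⇒domain j (ρ x) x-j)
                     (inside⇒domain j (ρ y) (subst (λ a → inComponent j a ≡ true) x≡y x-j)) x≡y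
  ... | elsewhere x-i x-j = trans (fixes-elements sw x x-i x-j) (trans x≡y (sym (fixes-elements sw y
          (subst (λ a → inComponent i a ≡ false) x≡y x-i) (subst (λ a → inComponent j a ≡ false) x≡y x-j))))

  membership-preserved : ∀ {i j d k m} {ρ ρ′ : Fin k → U} {σ σ′ : Fin m → U → Bool} → Swapped i j d ρ ρ′ σ σ′ →
    ∀ x Z → T (σ Z (ρ x)) → T (σ′ Z (ρ′ x))
  membership-preserved {i} {j} {ρ = ρ} {σ = σ} {σ′} sw x Z x∈Z with position i j (ρ x)
  ... | in-i x-i = subst T (FromSwap.Viaᵢ.membership-transfer sw x Z (inside⇒domain i (ρ x) x-i)) x∈Z
  ... | in-j x-j = subst T (FromSwap.Viaⱼ.membership-transfer sw x Z (inside⇒domain j (ρ x) x-j)) x∈Z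
  ... | elsewhere x-i x-j =
    subst T (sym (trans (cong (σ′ Z) (fixes-elements sw x x-i x-j)) (fixes-sets sw Z (ρ x) x-i x-j))) x∈Z

  answer-in-component : ∀ {i j d k m} {ρ ρ′ : Fin k → U} {σ σ′ : Fin m → U → Bool} → ¬ i ≡ j →
    Swapped i j (suc d) ρ ρ′ σ σ′ → ∀ a → inComponent i a ≡ true →
    Σ U λ a′ → Swapped i j d (extend a ρ) (extend a′ ρ′) σ σ′
  answer-in-component {i} {j} {d} {ρ = ρ} {ρ′} {σ} {σ′} i≢j sw a a-i = a′ , record
    { i↦j = λ { zero → trans a-i (sym a′-j) ; (suc x) → i↦j sw x }
    ; j↦i = λ { zero → trans (disjoint i j i≢j a a-i) (sym (disjoint j i j≢i a′ a′-j)) ; (suc x) → j↦i sw x }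
    ; fixes-elements = λ { zero a-out _ → ⊥-elim (true≢false a-i a-out) ; (suc x) → fixes-elements sw x }
    ; fixes-sets = fixes-sets sw
    ; codeᵢ≡codeⱼ = trans (local-extend (domain i) d a ρ σ) (trans answers (sym (local-extend (domain j) d a′ ρ′ σ′)))
    ; codeⱼ≡codeᵢ = trans (local-extend (domain j) d a ρ σ)
        (trans (back-outside (domain j) (domain i) d (local (domain j) ρ) (local (domain i) ρ′) σ σ′ (codeⱼ≡codeᵢ sw)
                  a a′ (outside-domain i j i≢j a a-i) (outside-domain j i j≢i a′ a′-j))
               (sym (local-extend (domain i) d a′ ρ′ σ′))) }
    where
    j≢i : ¬ j ≡ i
    j≢i j≡i = i≢j (sym j≡i)
    answer = back-inside (domain i) (domain j) d (local (domain i) ρ) (local (domain j) ρ′) σ σ′ (codeᵢ≡codeⱼ sw)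
               a (inside⇒domain i a a-i)
    a′ = proj₁ answer
    answers = proj₁ (proj₂ answer)
    a′-Dj = proj₁ (proj₂ (proj₂ answer))
    constant-only-if = proj₂ (proj₂ (proj₂ answer))
    -- a′ is no separator vertex: it would be a constant, and then so would a
    a′-j : inComponent j a′ ≡ true
    a′-j with ∨-true-cases _ _ a′-Dj
    ... | inj₁ a′-owned = a′-owned
    ... | inj₂ a′-sep = ⊥-elim (true≢false (subst (λ z → separatorVertex z ≡ true) (sym a≡c) (constant-separator t))
                                          (inside⇒not-separator i a a-i))
      where
      t = proj₁ (separator-constant a′ a′-sep)
      a≡c = constant-only-if t (proj₂ (separator-constant a′ a′-sep))

  answer-elsewhere : ∀ {i j d k m} {ρ ρ′ : Fin k → U} {σ σ′ : Fin m → U → Bool} →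
    Swapped i j (suc d) ρ ρ′ σ σ′ → ∀ a → inComponent i a ≡ false → inComponent j a ≡ false →
    Swapped i j d (extend a ρ) (extend a ρ′) σ σ′
  answer-elsewhere {i} {j} {d} {ρ = ρ} {ρ′} {σ} {σ′} sw a a-i a-j = record
    { i↦j = λ { zero → trans a-i (sym a-j) ; (suc x) → i↦j sw x }
    ; j↦i = λ { zero → trans a-j (sym a-i) ; (suc x) → j↦i sw x }
    ; fixes-elements = λ { zero _ _ → refl ; (suc x) → fixes-elements sw x }
    ; fixes-sets = fixes-sets sw
    ; codeᵢ≡codeⱼ = trans (local-extend (domain i) d a ρ σ)
        (trans (back-fixed (domain i) (domain j) d (local (domain i) ρ) (local (domain j) ρ′) σ σ′ (codeᵢ≡codeⱼ sw)
                  a same-domain (constant-if-in a-i))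
               (sym (local-extend (domain j) d a ρ′ σ′)))
    ; codeⱼ≡codeᵢ = trans (local-extend (domain j) d a ρ σ)
        (trans (back-fixed (domain j) (domain i) d (local (domain j) ρ) (local (domain i) ρ′) σ σ′ (codeⱼ≡codeᵢ sw)
                  a (sym same-domain) (constant-if-in a-j))
               (sym (local-extend (domain i) d a ρ′ σ′))) }
    where
    same-domain : domain i a ≡ domain j a
    same-domain = cong (_∨ separatorVertex a) (trans a-i (sym a-j))
    constant-if-in : ∀ {l} → inComponent l a ≡ false → domain l a ≡ true → Σ (Fin s) λ t → a ≡ inj₁ (core t)
    constant-if-in a-l a-Dl = separator-constant a (trans (sym (cong (_∨ separatorVertex a) a-l)) a-Dl)

  element-step : ∀ {i j d k m} {ρ ρ′ : Fin k → U} {σ σ′ : Fin m → U → Bool} → ¬ i ≡ j →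
    Swapped i j (suc d) ρ ρ′ σ σ′ → ∀ a → Σ U λ a′ → Swapped i j d (extend a ρ) (extend a′ ρ′) σ σ′
  element-step {i} {j} i≢j sw a with position i j a
  ... | in-i a-i = answer-in-component i≢j sw a a-i
  ... | in-j a-j = proj₁ answer , swap-roles (proj₂ answer)
    where answer = answer-in-component (λ j≡i → i≢j (sym j≡i)) (swap-roles sw) a a-j
  ... | elsewhere a-i a-j = a , answer-elsewhere sw a a-i a-j

  -- A set X is answered by the set that follows the answer to X from the
  -- domain of i on component j, the answer from the domain of j on
  -- component i, and X elsewhere.
  set-step : ∀ {i j d k m} {ρ ρ′ : Fin k → U} {σ σ′ : Fin m → U → Bool} → ¬ i ≡ j →
    Swapped i j (suc d) ρ ρ′ σ σ′ → ∀ X → Σ (U → Bool) λ Y → Swapped i j d ρ ρ′ (extend X σ) (extend Y σ′)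
  set-step {i} {j} {d} {ρ = ρ} {ρ′} {σ} {σ′} i≢j sw X = Y , record
    { i↦j = i↦j sw ; j↦i = j↦i sw ; fixes-elements = fixes-elements sw
    ; fixes-sets = λ { zero a a-i a-j → Y-elsewhere a a-j a-i ; (suc Z) → fixes-sets sw Z }
    ; codeᵢ≡codeⱼ = trans answersᵢ (code-cong (domain j) d (λ _ → refl) Y-on-Dj)
    ; codeⱼ≡codeᵢ = trans answersⱼ (code-cong (domain i) d (λ _ → refl) Y-on-Di) }
    where
    answerᵢ = back-set (domain i) (domain j) d (local (domain i) ρ) (local (domain j) ρ′) σ σ′ (codeᵢ≡codeⱼ sw) X
    Yⱼ = proj₁ answerᵢ
    answersᵢ = proj₂ answerᵢ
    answerⱼ = back-set (domain j) (domain i) d (local (domain j) ρ) (local (domain i) ρ′) σ σ′ (codeⱼ≡codeᵢ sw) X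
    Yᵢ = proj₁ answerⱼ
    answersⱼ = proj₂ answerⱼ

    Y : U → Bool
    Y a = if inComponent j a then Yⱼ a else (if inComponent i a then Yᵢ a else X a)

    Y-in-j : ∀ a → inComponent j a ≡ true → Y a ≡ Yⱼ a
    Y-in-j a a-j = cong (λ b → if b then Yⱼ a else (if inComponent i a then Yᵢ a else X a)) a-j
    Y-in-i : ∀ a → inComponent j a ≡ false → inComponent i a ≡ true → Y a ≡ Yᵢ a
    Y-in-i a a-j a-i = trans (cong (λ b → if b then Yⱼ a else (if inComponent i a then Yᵢ a else X a)) a-j)
                             (cong (λ b → if b then Yᵢ a else X a) a-i)
    Y-elsewhere : ∀ a → inComponent j a ≡ false → inComponent i a ≡ false → Y a ≡ X a
    Y-elsewhere a a-j a-i = trans (cong (λ b → if b then Yⱼ a else (if inComponent i a then Yᵢ a else X a)) a-j)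
                                  (cong (λ b → if b then Yᵢ a else X a) a-i)

    -- on a separator vertex both answers agree with X, hence with Y
    Y-on-separator : ∀ {Yₗ : U → Bool} → (∀ t → X (inj₁ (core t)) ≡ Yₗ (inj₁ (core t))) →
      ∀ a → separatorVertex a ≡ true → Yₗ a ≡ Y a
    Y-on-separator {Yₗ} X≡Yₗ a a-sep = subst (λ z → Yₗ z ≡ Y z) (sym a≡c) (trans (sym (X≡Yₗ t))
      (sym (Y-elsewhere (inj₁ (core t)) (separator⇒outside j _ (constant-separator t)) (separator⇒outside i _ (constant-separator t)))))
      where
      t = proj₁ (separator-constant a a-sep)
      a≡c = proj₂ (separator-constant a a-sep)

    Y-on-Dj : AgreeOn (domain j) (extend Yⱼ σ′) (extend Y σ′)
    Y-on-Dj (suc Z) a _ = refl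
    Y-on-Dj zero a a-Dj = owned-or-separator (∨-true-cases (inComponent j a) (separatorVertex a) a-Dj)
      where
      owned-or-separator : (inComponent j a ≡ true) ⊎ (separatorVertex a ≡ true) → Yⱼ a ≡ Y a
      owned-or-separator (inj₁ a-j)   = sym (Y-in-j a a-j)
      owned-or-separator (inj₂ a-sep) = Y-on-separator {Yⱼ} (λ t → agree-on-constants (domain i) (domain j) d _ _ σ σ′ X Yⱼ
        answersᵢ t (constant-in-domain i t) (constant-in-domain j t)) a a-sep

    Y-on-Di : AgreeOn (domain i) (extend Yᵢ σ′) (extend Y σ′)
    Y-on-Di (suc Z) a _ = refl
    Y-on-Di zero a a-Di = owned-or-separator (∨-true-cases (inComponent i a) (separatorVertex a) a-Di)
      where
      owned-or-separator : (inComponent i a ≡ true) ⊎ (separatorVertex a ≡ true) → Yᵢ a ≡ Y a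
      owned-or-separator (inj₁ a-i)   = sym (Y-in-i a (disjoint i j i≢j a a-i) a-i)
      owned-or-separator (inj₂ a-sep) = Y-on-separator {Yᵢ} (λ t → agree-on-constants (domain j) (domain i) d _ _ σ σ′ X Yᵢ
        answersⱼ t (constant-in-domain j t) (constant-in-domain i t)) a a-sep

  swap-preserves : ∀ {i j} → ¬ i ≡ j → ∀ d {k m} (φ : Formula k m) → depth φ ≤ d →
    ∀ {ρ ρ′ : Fin k → U} {σ σ′ : Fin m → U → Bool} → Swapped i j d ρ ρ′ σ σ′ → Sat G φ ρ σ → Sat G φ ρ′ σ′
  swap-preserves i≢j d (inc x y) _ sw holds = incidence-preserved sw x y holds
  swap-preserves i≢j d (eq x y)  _ sw holds = equality-preserved sw x y holds
  swap-preserves i≢j d (mem x Z) _ sw holds = membership-preserved sw x Z holds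
  swap-preserves i≢j d (neg φ) ≤d sw holds = λ holds′ → holds (swap-preserves i≢j d φ ≤d (swap-sides sw) holds′)
  swap-preserves i≢j d (and φ ψ) ≤d sw (φ-holds , ψ-holds) =
    swap-preserves i≢j d φ (≤-trans (m≤m⊔n _ _) ≤d) sw φ-holds , swap-preserves i≢j d ψ (≤-trans (m≤n⊔m _ _) ≤d) sw ψ-holds
  swap-preserves i≢j d (or φ ψ) ≤d sw (inj₁ φ-holds) = inj₁ (swap-preserves i≢j d φ (≤-trans (m≤m⊔n _ _) ≤d) sw φ-holds)
  swap-preserves i≢j d (or φ ψ) ≤d sw (inj₂ ψ-holds) = inj₂ (swap-preserves i≢j d ψ (≤-trans (m≤n⊔m _ _) ≤d) sw ψ-holds)
  swap-preserves i≢j (suc d) (ex1 φ) (s≤s ≤d) sw (a , holds) =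
    proj₁ step , swap-preserves i≢j d φ ≤d (proj₂ step) holds
    where step = element-step i≢j sw a
  swap-preserves i≢j (suc d) (all1 φ) (s≤s ≤d) sw holds a′ =
    swap-preserves i≢j d φ ≤d (swap-sides (proj₂ step)) (holds (proj₁ step))
    where step = element-step i≢j (swap-sides sw) a′
  swap-preserves i≢j (suc d) (ex2 φ) (s≤s ≤d) sw (X , holds) =
    proj₁ step , swap-preserves i≢j d φ ≤d (proj₂ step) holds
    where step = set-step i≢j sw X
  swap-preserves i≢j (suc d) (all2 φ) (s≤s ≤d) sw holds Y =
    swap-preserves i≢j d φ ≤d (swap-sides (proj₂ step)) (holds (proj₁ step))
    where step = set-step i≢j (swap-sides sw) Y

atomLog : ℕ → ℕ → ℕ → ℕ
atomLog s k m = k + (s * k + (m * k + (k * k + (k * k + m * s))))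

codeLog : (s k m d : ℕ) → ℕ
codeLog s k m zero    = atomLog s k m
codeLog s k m (suc d) = atomLog s k m + (2 ^ codeLog s (suc k) m d + 2 ^ codeLog s k (suc m) d)

size-table : ∀ a b → size (Table a b) ≡ 2 ^ (b * a)
size-table a b = trans (size-Vec a (Bits b)) (trans (cong (_^ a) (size-Vec b Boolᶠ)) (^-*-assoc 2 b a))

size-×-power : ∀ A B a b → size A ≡ 2 ^ a → size B ≡ 2 ^ b → size (A ×ᶠ B) ≡ 2 ^ (a + b)
size-×-power A B a b A≡ B≡ = trans (size-× A B) (trans (cong₂ _*_ A≡ B≡) (sym (^-distribˡ-+-* 2 a b)))

size-Atom : ∀ s k m → size (Atomᶠ s k m) ≡ 2 ^ atomLog s k m
size-Atom s k m =
  size-×-power (Bits k) T₁ k _ (size-Vec k Boolᶠ) (size-×-power (Table k s) T₂ (s * k) _ (size-table k s)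
    (size-×-power (Table k m) T₃ (m * k) _ (size-table k m) (size-×-power (Table k k) T₄ (k * k) _ (size-table k k)
      (size-×-power (Table k k) (Table s m) (k * k) (m * s) (size-table k k) (size-table s m)))))
  where
  T₄ = Table k k ×ᶠ Table s m
  T₃ = Table k k ×ᶠ T₄
  T₂ = Table k m ×ᶠ T₃
  T₁ = Table k s ×ᶠ T₂

size-Code : ∀ s k m d → size (Codeᶠ s k m d) ≡ 2 ^ codeLog s k m d
size-Code s k m zero    = size-Atom s k m
size-Code s k m (suc d) = size-×-power (Atomᶠ s k m) (Bits N₁ ×ᶠ Bits N₂) (atomLog s k m) _ (size-Atom s k m)
  (size-×-power (Bits N₁) (Bits N₂) (2 ^ codeLog s (suc k) m d) (2 ^ codeLog s k (suc m) d)
    (trans (size-Vec N₁ Boolᶠ) (cong (2 ^_) (size-Code s (suc k) m d)))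
    (trans (size-Vec N₂ Boolᶠ) (cong (2 ^_) (size-Code s k (suc m) d))))
  where
  N₁ = size (Codeᶠ s (suc k) m d)
  N₂ = size (Codeᶠ s k (suc m) d)

1≤2^n : ∀ n → 1 ≤ 2 ^ n
1≤2^n n = ^-monoʳ-≤ 2 (z≤n {n})

2^n+2^n≡2^1+n : ∀ n → 2 ^ n + 2 ^ n ≡ 2 ^ suc n
2^n+2^n≡2^1+n n = cong (2 ^ n +_) (sym (+-identityʳ (2 ^ n)))

n<2^n : ∀ n → n < 2 ^ n
n<2^n zero    = s≤s z≤n
n<2^n (suc n) = ≤-trans (s≤s (n<2^n n)) (≤-trans (+-mono-≤ (1≤2^n n) ≤-refl) (≤-reflexive (2^n+2^n≡2^1+n n)))

n+n≤2^n : ∀ n → n + n ≤ 2 ^ n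
n+n≤2^n zero    = z≤n
n+n≤2^n (suc n) = ≤-trans (+-mono-≤ (n<2^n n) (n<2^n n)) (≤-reflexive (2^n+2^n≡2^1+n n))

exp-mono : ∀ j {x y} → x ≤ y → exp j x ≤ exp j y
exp-mono zero    x≤y = x≤y
exp-mono (suc j) x≤y = ^-monoʳ-≤ 2 (exp-mono j x≤y)

exp-inflationary : ∀ j x → x ≤ exp j x
exp-inflationary zero    x = ≤-refl
exp-inflationary (suc j) x = ≤-trans (exp-inflationary j x) (<⇒≤ (n<2^n (exp j x)))

exp-+ : ∀ i j x → exp i (exp j x) ≡ exp (i + j) x
exp-+ zero    j x = refl
exp-+ (suc i) j x = cong (2 ^_) (exp-+ i j x)

+≤exp : ∀ c x → x + c ≤ exp c x
+≤exp zero    x = ≤-reflexive (+-identityʳ x)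
+≤exp (suc c) x = ≤-trans (≤-reflexive (+-suc x c)) (≤-trans (s≤s (+≤exp c x)) (n<2^n (exp c x)))

height : ℕ → ℕ
height zero    = 1
height (suc d) = suc (suc (height d))

atomLog-bound : ∀ {s k m} w → s ≤ w → k ≤ w → m ≤ w → atomLog s k m ≤ 2 ^ (3 + (w + w))
atomLog-bound {s} {k} {m} w s≤w k≤w m≤w = begin
  k + (s * k + (m * k + (k * k + (k * k + m * s))))
    ≤⟨ +-mono-≤ k≤P (+-mono-≤ (product s≤w k≤w) (+-mono-≤ (product m≤w k≤w)
         (+-mono-≤ (product k≤w k≤w) (+-mono-≤ (product k≤w k≤w) (product m≤w s≤w))))) ⟩
  P + (P + (P + (P + (P + P))))         ≤⟨ m≤m+n _ (P + P) ⟩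
  P + (P + (P + (P + (P + P)))) + (P + P) ≡⟨ six+two P ⟨
  8 * P                                 ≡⟨ cong (8 *_) (^-distribˡ-+-* 2 w w) ⟨
  2 ^ 3 * 2 ^ (w + w)                   ≡⟨ ^-distribˡ-+-* 2 3 (w + w) ⟨
  2 ^ (3 + (w + w))                     ∎
  where
  open ≤-Reasoning
  P = 2 ^ w * 2 ^ w
  below : ∀ {a} → a ≤ w → a ≤ 2 ^ w
  below a≤w = ≤-trans a≤w (<⇒≤ (n<2^n w))
  product : ∀ {a b} → a ≤ w → b ≤ w → a * b ≤ P
  product a≤w b≤w = *-mono-≤ (below a≤w) (below b≤w)
  k≤P : k ≤ P
  k≤P = ≤-trans (below k≤w) (≤-trans (≤-reflexive (sym (*-identityʳ (2 ^ w)))) (*-monoʳ-≤ (2 ^ w) (1≤2^n w)))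
  six+two : ∀ P → 8 * P ≡ P + (P + (P + (P + (P + P)))) + (P + P)
  six+two = solve-∀

codeLog-bound : ∀ d {s k m} w → s ≤ w → k + d ≤ w → m + d ≤ w → codeLog s k m d ≤ exp (height d) (3 + (w + w))
codeLog-bound zero {k = k} {m} w s≤w k≤w m≤w =
  atomLog-bound w s≤w (≤-trans (m≤m+n k 0) k≤w) (≤-trans (m≤m+n m 0) m≤w)
codeLog-bound (suc d) {s} {k} {m} w s≤w k+d≤w m+d≤w = begin
  atomLog s k m + (2 ^ codeLog s (suc k) m d + 2 ^ codeLog s k (suc m) d)
    ≤⟨ +-mono-≤ atom≤ (+-mono-≤ (^-monoʳ-≤ 2 more-elements) (^-monoʳ-≤ 2 more-sets)) ⟩
  2 ^ E + (2 ^ E + 2 ^ E)                  ≤⟨ m≤n+m _ (2 ^ E) ⟩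
  2 ^ E + (2 ^ E + (2 ^ E + 2 ^ E))       ≡⟨ four-times (2 ^ E) ⟩
  2 ^ E * 2 ^ 2                           ≡⟨ ^-distribˡ-+-* 2 E 2 ⟨
  2 ^ (E + 2)                             ≤⟨ ^-monoʳ-≤ 2 (≤-trans (+-monoʳ-≤ E 2≤E) (n+n≤2^n E)) ⟩
  2 ^ 2 ^ E                               ∎
  where
  open ≤-Reasoning
  X = 3 + (w + w)
  E = exp (height d) X
  2≤E : 2 ≤ E
  2≤E = ≤-trans (s≤s (s≤s z≤n)) (exp-inflationary (height d) X)
  atom≤ : atomLog s k m ≤ 2 ^ E
  atom≤ = ≤-trans (atomLog-bound w s≤w (≤-trans (m≤m+n k (suc d)) k+d≤w) (≤-trans (m≤m+n m (suc d)) m+d≤w))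
                  (^-monoʳ-≤ 2 (exp-inflationary (height d) X))
  more-elements : codeLog s (suc k) m d ≤ E
  more-elements = codeLog-bound d w s≤w (≤-trans (≤-reflexive (sym (+-suc k d))) k+d≤w)
                                        (≤-trans (+-monoʳ-≤ m (n≤1+n d)) m+d≤w)
  more-sets : codeLog s k (suc m) d ≤ E
  more-sets = codeLog-bound d w s≤w (≤-trans (+-monoʳ-≤ k (n≤1+n d)) k+d≤w)
                                    (≤-trans (≤-reflexive (sym (+-suc m d))) m+d≤w)
  four-times : ∀ P → P + (P + (P + P)) ≡ P * 2 ^ 2
  four-times = solve-∀

pairsHeight : (m q : ℕ) → ℕ
pairsHeight m q = suc (suc (height q)) + suc ((2 + q) + (m + q) + 2)

code-pairs-bound : ∀ {s} k m q → s ≤ k → size (Codeᶠ s 2 m q ×ᶠ Codeᶠ s 2 m q) ≤ exp (pairsHeight m q) k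
code-pairs-bound {s} k m q s≤k = begin
  size (Codeᶠ s 2 m q ×ᶠ Codeᶠ s 2 m q)
    ≡⟨ size-×-power (Codeᶠ s 2 m q) (Codeᶠ s 2 m q) L L (size-Code s 2 m q) (size-Code s 2 m q) ⟩
  2 ^ (L + L)                               ≤⟨ ^-monoʳ-≤ 2 (≤-trans (n+n≤2^n L) (^-monoʳ-≤ 2 L≤E)) ⟩
  exp (suc (suc (height q))) X              ≤⟨ exp-mono (suc (suc (height q))) X≤ ⟩
  exp (suc (suc (height q))) (exp (suc (c + 2)) k) ≡⟨ exp-+ (suc (suc (height q))) (suc (c + 2)) k ⟩
  exp (pairsHeight m q) k                   ∎
  where
  open ≤-Reasoning
  c = (2 + q) + (m + q)
  w = k + c
  X = 3 + (w + w)
  L = codeLog s 2 m q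
  L≤E : L ≤ exp (height q) X
  L≤E = codeLog-bound q w (≤-trans s≤k (m≤m+n k c))
          (≤-trans (m≤m+n (2 + q) (m + q)) (m≤n+m c k)) (≤-trans (m≤n+m (m + q) (2 + q)) (m≤n+m c k))
  double : ∀ w → 1 + (3 + (w + w)) ≡ (w + 2) + (w + 2)
  double = solve-∀
  X≤ : X ≤ exp (suc (c + 2)) k
  X≤ = begin
    3 + (w + w)            ≤⟨ n≤1+n X ⟩
    1 + (3 + (w + w))      ≡⟨ double w ⟩
    (w + 2) + (w + 2)      ≤⟨ n+n≤2^n (w + 2) ⟩
    2 ^ (w + 2)            ≡⟨ cong (2 ^_) (+-assoc k c 2) ⟩
    2 ^ (k + (c + 2))      ≤⟨ ^-monoʳ-≤ 2 (+≤exp (c + 2) k) ⟩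
    exp (suc (c + 2)) k    ∎

record Listing {n : ℕ} (S : Subset n) : Set where
  field
    count    : ℕ
    member   : Fin count → Fin n
    member∈S : ∀ t → member t ∈ S
    onto     : ∀ v → v ∈ S → Σ (Fin count) λ t → member t ≡ v
    count≤∣S∣ : count ≤ ∣ S ∣

listing : ∀ {n} (S : Subset n) → Listing S
listing [] = record { count = 0 ; member = λ () ; member∈S = λ () ; onto = λ () ; count≤∣S∣ = z≤n }
listing (inside ∷ S) = record
  { count = suc count ; member = member′ ; member∈S = member′∈S ; onto = onto′ ; count≤∣S∣ = s≤s count≤∣S∣ }
  where
  open Listing (listing S)
  member′ : Fin (suc count) → Fin _
  member′ zero    = zero
  member′ (suc t) = suc (member t)
  member′∈S : ∀ t → member′ t ∈ (inside ∷ S)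
  member′∈S zero    = here
  member′∈S (suc t) = there (member∈S t)
  onto′ : ∀ v → v ∈ (inside ∷ S) → Σ (Fin (suc count)) λ t → member′ t ≡ v
  onto′ zero    _          = zero , refl
  onto′ (suc v) (there v∈S) = suc (proj₁ (onto v v∈S)) , cong suc (proj₂ (onto v v∈S))
listing (outside ∷ S) = record
  { count = count ; member = suc ∘ member ; member∈S = λ t → there (member∈S t) ; onto = onto′ ; count≤∣S∣ = count≤∣S∣ }
  where
  open Listing (listing S)
  onto′ : ∀ v → v ∈ (outside ∷ S) → Σ (Fin count) λ t → suc (member t) ≡ v
  onto′ (suc v) (there v∈S) = proj₁ (onto v v∈S) , cong suc (proj₂ (onto v v∈S))

¬¬-all : ∀ {n} {P : Fin n → Set} → (∀ i → ¬ ¬ P i) → ¬ ¬ (∀ i → P i)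
¬¬-all {zero}  ¬¬P refute = refute λ ()
¬¬-all {suc n} ¬¬P refute = ¬¬P zero λ P₀ → ¬¬-all (¬¬P ∘ suc) λ Pₛ → refute λ { zero → P₀ ; (suc i) → Pₛ i }

-- Give component i the signature consisting of the
-- depth-q codes, relative to its domain, of its representative in either
-- argument position of φ.  If two components had the same signature,
-- swapping them would preserve φ, so φ(r i, r j) and φ(r j, r i) would both
-- hold (by totality and transfer), contradicting antisymmetry.  Hence
-- signatures are injective and there are at most as many components as
-- pairs of codes.
module ComponentCount (G : Graph) {m : ℕ} (φ : Formula 2 m) (P : Fin m → Univ G → Bool)
  (ordered : IsTotalOrder {A = Univ G} _≡_ (λ a b → Sat G φ (pairEnv a b) P))
  (S : Subset (n G)) {c : ℕ} (r : Fin c → Vertex G) (r∉S : ∀ i → r i ∉ S)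
  (separated : ∀ i j → ¬ i ≡ j → ¬ ConnAvoid G S (r i) (r j))
  (reaches? : ∀ i v → Dec (ConnAvoid G S v (r i))) where
  open IncidenceStructure G
  open Components G S r separated reaches?
  open Listing (listing S)
  open RelativeTypes G member
  open Swap G S r separated reaches? member member∈S onto
  open Swapped

  q = depth φ

  signature : Fin c → Carrier (Codeᶠ count 2 m q ×ᶠ Codeᶠ count 2 m q)
  signature i = code (domain i) q (pairEnv (just (inj₁ (r i))) nothing) P ,
                code (domain i) q (pairEnv nothing (just (inj₁ (r i)))) P

  owns : ∀ i → inComponent i (inj₁ (r i)) ≡ true
  owns i = representative-inside i (r∉S i)

  foreign : ∀ i j → ¬ i ≡ j → domain i (inj₁ (r j)) ≡ false
  foreign i j i≢j = outside-domain j i (λ j≡i → i≢j (sym j≡i)) (inj₁ (r j)) (owns j)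

  local-first : ∀ i j → ¬ i ≡ j → ∀ x →
    local (domain i) (pairEnv (inj₁ (r i)) (inj₁ (r j))) x ≡ pairEnv (just (inj₁ (r i))) nothing x
  local-first i j i≢j zero       = restrict-in (domain i) (inj₁ (r i)) (inside⇒domain i (inj₁ (r i)) (owns i))
  local-first i j i≢j (suc zero) = restrict-out (domain i) (inj₁ (r j)) (foreign i j i≢j)

  local-second : ∀ i j → ¬ i ≡ j → ∀ x →
    local (domain i) (pairEnv (inj₁ (r j)) (inj₁ (r i))) x ≡ pairEnv nothing (just (inj₁ (r i))) x
  local-second i j i≢j zero       = restrict-out (domain i) (inj₁ (r j)) (foreign i j i≢j)
  local-second i j i≢j (suc zero) = restrict-in (domain i) (inj₁ (r i)) (inside⇒domain i (inj₁ (r i)) (owns i))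

  exchange : ∀ i j → ¬ i ≡ j → signature i ≡ signature j →
    Swapped i j q (pairEnv (inj₁ (r i)) (inj₁ (r j))) (pairEnv (inj₁ (r j)) (inj₁ (r i))) P P
  exchange i j i≢j same = record
    { i↦j = λ { zero → trans (owns i) (sym (owns j)) ; (suc zero) → trans j∉i (sym i∉j) }
    ; j↦i = λ { zero → trans i∉j (sym j∉i) ; (suc zero) → trans (owns j) (sym (owns i)) }
    ; fixes-elements = λ { zero out _ → ⊥-elim (true≢false (owns i) out) ; (suc zero) _ out → ⊥-elim (true≢false (owns j) out) }
    ; fixes-sets = λ _ _ _ _ → refl
    ; codeᵢ≡codeⱼ = trans (code-cong (domain i) q (local-first i j i≢j) no-sets)
                          (trans (cong proj₁ same) (sym (code-cong (domain j) q (local-first j i j≢i) no-sets)))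
    ; codeⱼ≡codeᵢ = trans (code-cong (domain j) q (local-second j i j≢i) no-sets)
                          (trans (cong proj₂ (sym same)) (sym (code-cong (domain i) q (local-second i j i≢j) no-sets))) }
    where
    j≢i : ¬ j ≡ i
    j≢i j≡i = i≢j (sym j≡i)
    i∉j : inComponent j (inj₁ (r i)) ≡ false
    i∉j = disjoint i j i≢j (inj₁ (r i)) (owns i)
    j∉i : inComponent i (inj₁ (r j)) ≡ false
    j∉i = disjoint j i j≢i (inj₁ (r j)) (owns j)
    no-sets : ∀ {D} → AgreeOn D P P
    no-sets _ _ _ = refl

  signature-injective : ∀ i j → signature i ≡ signature j → i ≡ j
  signature-injective i j same with i ≟ᶠ j
  ... | yes i≡j = i≡j
  ... | no i≢j  = ⊥-elim (separated i j i≢j (subst (ConnAvoid G S (r i)) (inj₁-injective ri≡rj) ε))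
    where
    a = inj₁ (r i)
    b = inj₁ (r j)
    transfer : Sat G φ (pairEnv a b) P → Sat G φ (pairEnv b a) P
    transfer = swap-preserves i≢j q φ ≤-refl (exchange i j i≢j same)
    transfer⁻ : Sat G φ (pairEnv b a) P → Sat G φ (pairEnv a b) P
    transfer⁻ = swap-preserves i≢j q φ ≤-refl (swap-sides (exchange i j i≢j same))
    ri≡rj : a ≡ b
    ri≡rj with IsTotalOrder.total ordered a b
    ... | inj₁ a≤b = IsTotalOrder.antisym ordered a≤b (transfer a≤b)
    ... | inj₂ b≤a = IsTotalOrder.antisym ordered (transfer⁻ b≤a) b≤a

  components-bound : c ≤ size (Codeᶠ count 2 m q ×ᶠ Codeᶠ count 2 m q)
  components-bound = injection⇒≤size (Codeᶠ count 2 m q ×ᶠ Codeᶠ count 2 m q) signature signature-injective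

-- A graph
-- with a component has a vertex, hence an order; reachability in G − S is
-- decided under a double negation, which the decidable bound discharges.
corollary4p5 : (C : GraphClass) → MSO2Orderable C →
    Σ (ℕ → ℕ) (λ f → Elementary f × HasSEP C f)
corollary4p5 C (m , φ , orderable) = exp h , (h , λ k → ≤-refl) , separation-bounded
  where
  h = pairsHeight m (depth φ)
  separation-bounded : HasSEP C (exp h)
  separation-bounded G G∈C k S ∣S∣≤k zero _ = z≤n
  separation-bounded G G∈C k S ∣S∣≤k c@(suc _) (r , r∉S , separated , _) =
    ≤-trans (decidable-stable (c ≤? N) counted) (code-pairs-bound k m (depth φ) (≤-trans count≤∣S∣ ∣S∣≤k))
    where
    open Listing (listing S)
    N = size (Codeᶠ count 2 m (depth φ) ×ᶠ Codeᶠ count 2 m (depth φ))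
    order = orderable G G∈C (>-nonZero⁻¹ (n G) {{nonZeroIndex (r zero)}})
    counted : ¬ ¬ (c ≤ N)
    counted = ¬¬-map (ComponentCount.components-bound G φ (proj₁ order) (proj₂ order) S r r∉S separated)
                     (¬¬-all λ i → ¬¬-all λ v → ¬¬-excluded-middle)
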